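{- Let $n,\ell,q$ be positive integers. If there exists a completely balanced edge-coloring of $K_n$ with $\ell$ colors and no rainbow $K_q$, then for every $k\ge 1$ there exists a completely balanced edge-coloring of $K_{n^k}$ with $\ell$ colors and no rainbow $K_q$. In particular, if $n\equiv 1\pmod{\binom{q}{2}}$ and $d(n,K_q)=\infty$, then $d(n^k,K_q)=\infty$ for all $k\ge 1$.
   Context: $K_n$ denotes the complete graph on $n$ vertices. An edge-coloring of $K_n$ using a set $C$ of $\ell$ colors, where $\ell$ divides $n-1$, is completely balanced if every vertex is incident to exactly $(n-1)/\ell$ edges of each color of $C$. A subgraph is rainbow if all its edges receive distinct colors. An $(\ell,d)$-coloring of $K_n$ is an edge-coloring using exactly $\ell$ colors in total such that every vertex is incident to at least $d$ edges of every color. For a graph $F$ with $\ell$ edges, $d(n,F)=\infty$ if $K_n$ has an $(\ell,\lfloor (n-1)/\ell\rfloor)$-coloring without a rainbow copy of $F$; otherwise $d(n,F)$ is the smallest integer $d$ such that every $(\ell,d)$-coloring of $K_n$ contains a rainbow copy of $F$. -}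

module Defs where

open import Data.Nat using (ℕ; suc; _+_; _*_; _∸_; _≤_; _<_)
open import Data.Nat.Divisibility using (_∣_)
open import Data.Fin using (Fin; _≟_) renaming (_<_ to _<ᶠ_)
open import Data.List using (List; length; filter; allFin)
open import Data.Product using (Σ; ∃; _×_; _,_)
open import Relation.Nullary using (¬_)
open import Relation.Nullary.Decidable using (¬?; _×-dec_)
open import Relation.Binary.PropositionalEquality using (_≡_; _≢_)
open import Function.Definitions using (Injective)

-- An edge-colouring of K_n with the colour set Fin ℓ: a symmetric
-- function on pairs of vertices (values on the diagonal are irrelevant).
Coloring : ℕ → ℕ → Set
Coloring n ℓ = Σ (Fin n → Fin n → Fin ℓ) λ c → ∀ u v → c u v ≡ c v u

colour : ∀ {n ℓ} → Coloring n ℓ → Fin n → Fin n → Fin ℓ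
colour (c , _) = c

deg : ∀ {n ℓ} → Coloring n ℓ → Fin n → Fin ℓ → ℕ
deg {n} χ v a =
  length (filter (λ u → ¬? (u ≟ v) ×-dec (colour χ v u ≟ a)) (allFin n))

CompletelyBalanced : ∀ {n ℓ} → Coloring n ℓ → Set
CompletelyBalanced {n} {ℓ} χ =
  (ℓ ∣ n ∸ 1) × (∀ v a → deg χ v a * ℓ ≡ n ∸ 1)

RainbowK : ∀ {n ℓ} → ℕ → Coloring n ℓ → Set
RainbowK {n} q χ =
  Σ (Fin q → Fin n) λ f → Injective _≡_ _≡_ f ×
    (∀ i j i′ j′ → i <ᶠ j → i′ <ᶠ j′ →
      colour χ (f i) (f j) ≡ colour χ (f i′) (f j′) → (i ≡ i′) × (j ≡ j′))

UsesAllColours : ∀ {n ℓ} → Coloring n ℓ → Set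
UsesAllColours {n} {ℓ} χ = ∀ (a : Fin ℓ) → ∃ λ u → ∃ λ v → u ≢ v × colour χ u v ≡ a

LDColoring : ∀ {n ℓ} → Coloring n ℓ → ℕ → Set
LDColoring χ d = UsesAllColours χ × (∀ v a → d ≤ deg χ v a)

IsFloorDiv : ℕ → ℕ → ℕ → Set
IsFloorDiv m ℓ d = (d * ℓ ≤ m) × (m < suc d * ℓ)

-- d(n, F) = ∞ for F = K_q (which has ℓ = C(q,2) edges, passed as ℓ):
-- K_n has an (ℓ, ⌊(n-1)/ℓ⌋)-colouring with no rainbow K_q.
DInfinityK : (n q ℓ : ℕ) → Set
DInfinityK n q ℓ = ∃ λ d → IsFloorDiv (n ∸ 1) ℓ d ×
  (∃ λ (χ : Coloring n ℓ) → LDColoring χ d × ¬ RainbowK q χ)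

-- Blow up every vertex of a colouring χ of K_a into a copy of a colouring ψ
-- of K_b: edges inside a copy are coloured by ψ, edges between the copies of
-- i and i′ by χ(i,i′).  A vertex of the blow-up has b·deg_χ + deg_ψ edges of
-- each colour, so complete balance and lower bounds on the degrees survive.
-- A rainbow K_q of the blow-up either meets every copy at most once, and then
-- it is a rainbow K_q of χ, or it meets some copy twice; then it lies inside
-- that copy, since a third vertex outside would see both of them in the same
-- colour, and it is a rainbow K_q of ψ.  Iterating the blow-up of χ starting
-- from K_1 gives the colourings of K_{n^k}.  When ℓ ∣ n − 1 the floor
-- ⌊(n − 1)/ℓ⌋ = d is exact, and the resulting lower bound d(n^k − 1)/(n − 1)
-- on the degrees is again the exact ⌊(n^k − 1)/ℓ⌋.
module Submission where

open import Defs
open import Data.Nat using (ℕ; _≤_; _∸_; _^_)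
open import Data.Nat.Divisibility using (_∣_)
open import Data.Nat.Combinatorics using (_C_)
open import Data.Product using (∃; _×_)
open import Relation.Nullary using (¬_)

open import Algebra.Properties.Semiring.Sum as Sum using ()
open import Data.Bool.Base using (if_then_else_)
open import Data.Nat.Base using (zero; suc; _+_; _*_; NonZero; >-nonZero⁻¹; s≤s; z≤n)
open import Data.Nat.Divisibility using (divides)
open import Data.Nat.Properties
  using ( +-*-semiring; +-comm; +-assoc; +-identityʳ; *-zeroʳ; *-comm; *-assoc; *-identityˡ
        ; *-distribʳ-+; *-cancelʳ-≡; *-cancelʳ-≤; *-cancelʳ-<
        ; ≤-antisym; ≤-reflexive; ≤-trans; ≤-pred; m<n+m; +-mono-≤; *-monoʳ-≤; m^n≢0)
open import Data.Fin.Base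
  using (Fin; zero; suc; _↑ˡ_; _↑ʳ_; combine; quotient; remainder; funToFin)
  renaming (_<_ to _<ᶠ_)
open import Data.Fin.Properties
  using (_≟_; any?; <-cmp; <⇒≢; nonZeroIndex; remQuot-combine; combine-remQuot; combine-injective)
open import Data.List.Base using (length; filter; tabulate)
open import Data.Product using (_,_; proj₁; proj₂)
open import Function.Base using (_∘_)
open import Function.Definitions using (Injective)
open import Relation.Binary.Definitions using (tri<; tri≈; tri>)
open import Relation.Binary.PropositionalEquality
  using (_≡_; _≢_; refl; sym; trans; cong; cong₂; module ≡-Reasoning)
open import Relation.Nullary using (Dec; yes; no; does; contradiction)
open import Relation.Nullary.Decidable using (¬?; _×-dec_; dec-true; dec-false)
open import Relation.Unary using (Decidable)

open Sum +-*-semiring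
  using (sum; sum-syntax; sum-cong-≗; sum-replicate-zero; ∑-distrib-+; *-distribˡ-sum; *-distribʳ-sum)

private variable
  a b n ℓ q : ℕ

𝟙 : ∀ {p} {P : Set p} → Dec P → ℕ
𝟙 P? = if does P? then 1 else 0

𝟙-yes : ∀ {p} {P : Set p} (P? : Dec P) → P → 𝟙 P? ≡ 1
𝟙-yes P? p = cong (if_then 1 else 0) (dec-true P? p)

𝟙-no : ∀ {p} {P : Set p} (P? : Dec P) → ¬ P → 𝟙 P? ≡ 0
𝟙-no P? ¬p = cong (if_then 1 else 0) (dec-false P? ¬p)

𝟙-cong : ∀ {p r} {P : Set p} {R : Set r} (P? : Dec P) (R? : Dec R) →
         (P → R) → (R → P) → 𝟙 P? ≡ 𝟙 R?
𝟙-cong P? R? P→R R→P with R?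
... | yes r = 𝟙-yes P? (R→P r)
... | no ¬r = 𝟙-no P? (¬r ∘ P→R)

length-filter-tabulate : ∀ {p} {A : Set} {P : A → Set p} (P? : Decidable P) (f : Fin n → A) →
                         length (filter P? (tabulate f)) ≡ ∑[ i < n ] 𝟙 (P? (f i))
length-filter-tabulate {zero}  P? f = refl
length-filter-tabulate {suc n} P? f with P? (f zero)
... | yes _ = cong suc (length-filter-tabulate P? (f ∘ suc))
... | no  _ = length-filter-tabulate P? (f ∘ suc)

∑-const : ∀ n x → ∑[ i < n ] x ≡ n * x
∑-const zero    x = refl
∑-const (suc n) x = cong (x +_) (∑-const n x)

∑-𝟙-≟ : ∀ {n} (i : Fin n) → ∑[ k < n ] 𝟙 (k ≟ i) ≡ 1
∑-𝟙-≟ {suc n} zero    = cong suc (sum-replicate-zero n)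
∑-𝟙-≟ {suc n} (suc i) = ∑-𝟙-≟ i

∑-↑ : ∀ m {n} (f : Fin (m + n) → ℕ) →
      sum f ≡ ∑[ i < m ] f (i ↑ˡ n) + ∑[ j < n ] f (m ↑ʳ j)
∑-↑ zero    f = refl
∑-↑ (suc m) f = trans (cong (f zero +_) (∑-↑ m (f ∘ suc))) (sym (+-assoc (f zero) _ _))

∑-combine : ∀ m {n} (f : Fin (m * n) → ℕ) →
            sum f ≡ ∑[ i < m ] ∑[ j < n ] f (combine i j)
∑-combine zero    f = refl
∑-combine (suc m) {n} f =
  trans (∑-↑ n f) (cong (∑[ j < n ] f (j ↑ˡ m * n) +_) (∑-combine m (f ∘ (n ↑ʳ_))))

deg-sum : (χ : Coloring n ℓ) (v : Fin n) (c : Fin ℓ) →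
          deg χ v c ≡ ∑[ u < n ] 𝟙 (¬? (u ≟ v) ×-dec (colour χ v u ≟ c))
deg-sum χ v c = length-filter-tabulate (λ u → ¬? (u ≟ v) ×-dec (colour χ v u ≟ c)) (λ u → u)

quotient-combine : (i : Fin a) (j : Fin b) → quotient b (combine i j) ≡ i
quotient-combine i j = cong proj₁ (remQuot-combine i j)

remainder-combine : (i : Fin a) (j : Fin b) → remainder {a} b (combine i j) ≡ j
remainder-combine i j = cong proj₂ (remQuot-combine i j)

module _ (χ : Coloring a ℓ) (ψ : Coloring b ℓ) where

  private
    block : Fin (a * b) → Fin a
    block = quotient b
    position : Fin (a * b) → Fin b
    position = remainder {a} b

  ⊗-colour : Fin (a * b) → Fin (a * b) → Fin ℓ
  ⊗-colour u v with block u ≟ block v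
  ... | yes _ = colour ψ (position u) (position v)
  ... | no  _ = colour χ (block u) (block v)

  ⊗-colour-inside : ∀ {u v} → block u ≡ block v → ⊗-colour u v ≡ colour ψ (position u) (position v)
  ⊗-colour-inside {u} {v} eq with block u ≟ block v
  ... | yes _  = refl
  ... | no  ne = contradiction eq ne

  ⊗-colour-across : ∀ {u v} → block u ≢ block v → ⊗-colour u v ≡ colour χ (block u) (block v)
  ⊗-colour-across {u} {v} ne with block u ≟ block v
  ... | yes eq = contradiction eq ne
  ... | no  _  = refl

  ⊗-colour-sym : ∀ u v → ⊗-colour u v ≡ ⊗-colour v u
  ⊗-colour-sym u v with block u ≟ block v
  ... | yes eq = trans (proj₂ ψ _ _) (sym (⊗-colour-inside (sym eq)))
  ... | no  ne = trans (proj₂ χ _ _) (sym (⊗-colour-across (ne ∘ sym)))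

infixl 7 _⊗_
_⊗_ : Coloring a ℓ → Coloring b ℓ → Coloring (a * b) ℓ
χ ⊗ ψ = ⊗-colour χ ψ , ⊗-colour-sym χ ψ

module _ (χ : Coloring a ℓ) (ψ : Coloring b ℓ) where

  ⊗-colour-same-block : ∀ i j j′ → colour (χ ⊗ ψ) (combine i j) (combine i j′) ≡ colour ψ j j′
  ⊗-colour-same-block i j j′ = begin
    ⊗-colour χ ψ (combine i j) (combine i j′)
      ≡⟨ ⊗-colour-inside χ ψ (trans (quotient-combine i j) (sym (quotient-combine i j′))) ⟩
    colour ψ (remainder {a} b (combine i j)) (remainder {a} b (combine i j′))
      ≡⟨ cong₂ (colour ψ) (remainder-combine i j) (remainder-combine i j′) ⟩
    colour ψ j j′ ∎
    where open ≡-Reasoning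

  ⊗-colour-other-block : ∀ {i i′} j j′ → i ≢ i′ →
                         colour (χ ⊗ ψ) (combine i j) (combine i′ j′) ≡ colour χ i i′
  ⊗-colour-other-block {i} {i′} j j′ ne = begin
    ⊗-colour χ ψ (combine i j) (combine i′ j′)
      ≡⟨ ⊗-colour-across χ ψ (λ eq → ne (trans (sym (quotient-combine i j)) (trans eq (quotient-combine i′ j′)))) ⟩
    colour χ (quotient b (combine i j)) (quotient b (combine i′ j′))
      ≡⟨ cong₂ (colour χ) (quotient-combine i j) (quotient-combine i′ j′) ⟩
    colour χ i i′ ∎
    where open ≡-Reasoning

  deg-⊗-combine : ∀ i j c → deg (χ ⊗ ψ) (combine i j) c ≡ b * deg χ i c + deg ψ j c
  deg-⊗-combine i j c = begin
    deg (χ ⊗ ψ) v c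
      ≡⟨ deg-sum (χ ⊗ ψ) v c ⟩
    ∑[ u < a * b ] 𝟙 (Edge? u)
      ≡⟨ ∑-combine a (𝟙 ∘ Edge?) ⟩
    ∑[ i′ < a ] ∑[ j′ < b ] 𝟙 (Edge? (combine i′ j′))
      ≡⟨ sum-cong-≗ block-count ⟩
    ∑[ i′ < a ] (𝟙 (i′ ≟ i) * deg ψ j c + b * 𝟙 (χ-Edge? i′))
      ≡⟨ ∑-distrib-+ (λ i′ → 𝟙 (i′ ≟ i) * deg ψ j c) (λ i′ → b * 𝟙 (χ-Edge? i′)) ⟩
    ∑[ i′ < a ] (𝟙 (i′ ≟ i) * deg ψ j c) + ∑[ i′ < a ] (b * 𝟙 (χ-Edge? i′))
      ≡⟨ cong₂ _+_ (sym (*-distribʳ-sum (deg ψ j c) (λ i′ → 𝟙 (i′ ≟ i))))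
                   (sym (*-distribˡ-sum b (𝟙 ∘ χ-Edge?))) ⟩
    ∑[ i′ < a ] 𝟙 (i′ ≟ i) * deg ψ j c + b * ∑[ i′ < a ] 𝟙 (χ-Edge? i′)
      ≡⟨ cong₂ _+_ (trans (cong (_* deg ψ j c) (∑-𝟙-≟ i)) (*-identityˡ (deg ψ j c)))
                   (cong (b *_) (sym (deg-sum χ i c))) ⟩
    deg ψ j c + b * deg χ i c
      ≡⟨ +-comm (deg ψ j c) _ ⟩
    b * deg χ i c + deg ψ j c ∎
    where
    open ≡-Reasoning
    v = combine i j
    Edge? = λ u → ¬? (u ≟ v) ×-dec (colour (χ ⊗ ψ) v u ≟ c)
    χ-Edge? = λ i′ → ¬? (i′ ≟ i) ×-dec (colour χ i i′ ≟ c)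
    ψ-Edge? = λ j′ → ¬? (j′ ≟ j) ×-dec (colour ψ j j′ ≟ c)

    -- Once `i′ ≟ i` is abstracted, both indicators on the right compute.
    block-count : ∀ i′ → ∑[ j′ < b ] 𝟙 (Edge? (combine i′ j′)) ≡
                         𝟙 (i′ ≟ i) * deg ψ j c + b * 𝟙 (χ-Edge? i′)
    block-count i′ with i′ ≟ i
    ... | yes refl = begin
      ∑[ j′ < b ] 𝟙 (Edge? (combine i j′))
        ≡⟨ sum-cong-≗ (λ j′ → 𝟙-cong (Edge? (combine i j′)) (ψ-Edge? j′)
             (λ (ne , eq) → (ne ∘ cong (combine i)) , trans (sym (⊗-colour-same-block i j j′)) eq)
             (λ (ne , eq) → (ne ∘ proj₂ ∘ combine-injective i j′ i j) , trans (⊗-colour-same-block i j j′) eq)) ⟩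
      ∑[ j′ < b ] 𝟙 (ψ-Edge? j′)
        ≡⟨ sym (deg-sum ψ j c) ⟩
      deg ψ j c
        ≡⟨ sym (+-identityʳ _) ⟩
      deg ψ j c + 0
        ≡⟨ cong₂ _+_ (sym (*-identityˡ _)) (sym (*-zeroʳ b)) ⟩
      1 * deg ψ j c + b * 0 ∎
    ... | no ne = begin
      ∑[ j′ < b ] 𝟙 (Edge? (combine i′ j′))
        ≡⟨ sum-cong-≗ (λ j′ → 𝟙-cong (Edge? (combine i′ j′)) (colour χ i i′ ≟ c)
             (λ (_ , eq) → trans (sym (⊗-colour-other-block j j′ (ne ∘ sym))) eq)
             (λ eq → (ne ∘ sym ∘ proj₁ ∘ combine-injective i j i′ j′ ∘ sym) , trans (⊗-colour-other-block j j′ (ne ∘ sym)) eq)) ⟩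
      ∑[ j′ < b ] 𝟙 (colour χ i i′ ≟ c)
        ≡⟨ ∑-const b _ ⟩
      b * 𝟙 (colour χ i i′ ≟ c) ∎

  deg-⊗ : ∀ v c → deg (χ ⊗ ψ) v c ≡ b * deg χ (quotient b v) c + deg ψ (remainder {a} b v) c
  deg-⊗ v c = trans (cong (λ u → deg (χ ⊗ ψ) u c) (sym (combine-remQuot {a} b v)))
                    (deg-⊗-combine (quotient b v) (remainder {a} b v) c)

  usesAllColours-⊗ : Fin b → UsesAllColours χ → UsesAllColours (χ ⊗ ψ)
  usesAllColours-⊗ j χ-all c with χ-all c
  ... | u , v , u≢v , eq =
    combine u j , combine v j , u≢v ∘ proj₁ ∘ combine-injective u j v j ,
    trans (⊗-colour-other-block j j u≢v) eq

RainbowEdges : Coloring n ℓ → (Fin q → Fin n) → Set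
RainbowEdges {q = q} χ f = ∀ (i j i′ j′ : Fin q) → i <ᶠ j → i′ <ᶠ j′ →
  colour χ (f i) (f j) ≡ colour χ (f i′) (f j′) → (i ≡ i′) × (j ≡ j′)

rainbowEdges-transport : ∀ {m} (χ : Coloring n ℓ) (ψ : Coloring m ℓ) {f : Fin q → Fin n} {g : Fin q → Fin m} →
                         (∀ {i j} → i <ᶠ j → colour χ (f i) (f j) ≡ colour ψ (g i) (g j)) →
                         RainbowEdges χ f → RainbowEdges ψ g
rainbowEdges-transport χ ψ same f-rb i j i′ j′ i<j i′<j′ eq =
  f-rb i j i′ j′ i<j i′<j′ (trans (same i<j) (trans eq (sym (same i′<j′))))

rainbowEdges-star : (χ : Coloring n ℓ) {f : Fin q → Fin n} → RainbowEdges χ f →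
                    ∀ {i j k} → i ≢ k → j ≢ k → colour χ (f i) (f k) ≡ colour χ (f j) (f k) → i ≡ j
rainbowEdges-star χ {f} f-rb {i} {j} {k} i≢k j≢k eq with <-cmp i k | <-cmp j k
... | tri≈ _ i≡k _ | _             = contradiction i≡k i≢k
... | _            | tri≈ _ j≡k _  = contradiction j≡k j≢k
... | tri< i<k _ _ | tri< j<k _ _  = proj₁ (f-rb i k j k i<k j<k eq)
... | tri< i<k _ _ | tri> _ _ k<j  =
  contradiction (proj₁ (f-rb i k k j i<k k<j (trans eq (proj₂ χ (f j) (f k))))) i≢k
... | tri> _ _ k<i | tri< j<k _ _  =
  contradiction (sym (proj₁ (f-rb k i j k k<i j<k (trans (proj₂ χ (f k) (f i)) eq)))) j≢k
... | tri> _ _ k<i | tri> _ _ k<j  =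
  proj₂ (f-rb k i k j k<i k<j (trans (proj₂ χ (f k) (f i)) (trans eq (proj₂ χ (f j) (f k)))))

quotient-remainder-injective : ∀ {u v : Fin (a * b)} →
  quotient {a} b u ≡ quotient b v → remainder {a} b u ≡ remainder {a} b v → u ≡ v
quotient-remainder-injective {a} {b} {u} {v} eq₁ eq₂ =
  trans (sym (combine-remQuot {a} b u)) (trans (cong₂ (combine {a}) eq₁ eq₂) (combine-remQuot {a} b v))

collision? : (g : Fin q → Fin a) → Dec (∃ λ i → ∃ λ j → i ≢ j × g i ≡ g j)
collision? g = any? λ i → any? λ j → ¬? (i ≟ j) ×-dec (g i ≟ g j)

no-collision⇒injective : (g : Fin q → Fin a) → ¬ (∃ λ i → ∃ λ j → i ≢ j × g i ≡ g j) → Injective _≡_ _≡_ g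
no-collision⇒injective g none {i} {j} eq with i ≟ j
... | yes i≡j = i≡j
... | no  i≢j = contradiction (i , j , i≢j , eq) none

module _ (χ : Coloring a ℓ) (ψ : Coloring b ℓ) {f : Fin q → Fin (a * b)}
         (f-rb : RainbowEdges (χ ⊗ ψ) f) where

  private
    block : Fin q → Fin a
    block = quotient b ∘ f
    position : Fin q → Fin b
    position = remainder {a} b ∘ f

  rainbow-across-blocks : Injective _≡_ _≡_ block → RainbowK q χ
  rainbow-across-blocks block-inj =
    block , block-inj , rainbowEdges-transport (χ ⊗ ψ) χ (λ i<j → ⊗-colour-across χ ψ (<⇒≢ i<j ∘ block-inj)) f-rb

  rainbow-inside-block : Injective _≡_ _≡_ f → ∀ {i j} → i ≢ j → block i ≡ block j → RainbowK q ψ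
  rainbow-inside-block f-inj {i} {j} i≢j same =
    position , position-inj , rainbowEdges-transport (χ ⊗ ψ) ψ (λ {k} {l} _ → ⊗-colour-inside χ ψ (same-block k l)) f-rb
    where
    one-block : ∀ k → block k ≡ block i
    one-block k with block k ≟ block i
    ... | yes eq = eq
    ... | no  ne = contradiction (rainbowEdges-star (χ ⊗ ψ) f-rb i≢k j≢k colours) i≢j
      where
      i≢k : i ≢ k
      i≢k refl = ne refl
      j≢k : j ≢ k
      j≢k refl = ne (sym same)
      colours : colour (χ ⊗ ψ) (f i) (f k) ≡ colour (χ ⊗ ψ) (f j) (f k)
      colours = begin
        colour (χ ⊗ ψ) (f i) (f k) ≡⟨ ⊗-colour-across χ ψ (ne ∘ sym) ⟩
        colour χ (block i) (block k) ≡⟨ cong (λ x → colour χ x (block k)) same ⟩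
        colour χ (block j) (block k) ≡⟨ ⊗-colour-across χ ψ (ne ∘ sym ∘ trans same) ⟨
        colour (χ ⊗ ψ) (f j) (f k) ∎
        where open ≡-Reasoning
    same-block : ∀ k l → block k ≡ block l
    same-block k l = trans (one-block k) (sym (one-block l))
    position-inj : Injective _≡_ _≡_ position
    position-inj {k} {l} eq = f-inj (quotient-remainder-injective (same-block k l) eq)

rainbowFree-⊗ : (χ : Coloring a ℓ) (ψ : Coloring b ℓ) →
                ¬ RainbowK q χ → ¬ RainbowK q ψ → ¬ RainbowK q (χ ⊗ ψ)
rainbowFree-⊗ {b = b} χ ψ no-χ no-ψ (f , f-inj , f-rb) with collision? (quotient b ∘ f)
... | no  none                   = no-χ (rainbow-across-blocks χ ψ f-rb (no-collision⇒injective _ none))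
... | yes (_ , _ , i≢j , same) = no-ψ (rainbow-inside-block χ ψ f-rb f-inj i≢j same)

K₁ : Fin ℓ → Coloring 1 ℓ
K₁ c = (λ _ _ → c) , (λ _ _ → refl)

rainbowFree-K₁ : ∀ {c : Fin ℓ} → 2 ≤ q → ¬ RainbowK q (K₁ c)
rainbowFree-K₁ (s≤s (s≤s _)) (f , f-inj , _) =
  contradiction (f-inj (single-vertex (f zero) (f (suc zero)))) λ ()
  where
  single-vertex : (u v : Fin 1) → u ≡ v
  single-vertex zero zero = refl

-- A single vertex is a rainbow K_0 and a rainbow K_1.
rainbowFree⇒2≤q : (χ : Coloring n ℓ) → Fin n → ¬ RainbowK q χ → 2 ≤ q
rainbowFree⇒2≤q {q = zero}          χ v no-rainbow =
  contradiction ((λ ()) , (λ { {()} }) , λ ()) no-rainbow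
rainbowFree⇒2≤q {q = suc zero}      χ v no-rainbow =
  contradiction ((λ _ → v) , (λ { {zero} {zero} _ → refl }) , λ { zero zero _ _ () _ }) no-rainbow
rainbowFree⇒2≤q {q = suc (suc _)} χ v no-rainbow = s≤s (s≤s z≤n)

power : Fin ℓ → Coloring n ℓ → (k : ℕ) → Coloring (n ^ k) ℓ
power c χ zero    = K₁ c
power c χ (suc k) = χ ⊗ power c χ k

-- d (n^k − 1)/(n − 1): the degrees of the k-th power of a colouring whose degrees are all d.
iteratedDegree : ℕ → ℕ → ℕ → ℕ
iteratedDegree n d zero    = 0
iteratedDegree n d (suc k) = n ^ k * d + iteratedDegree n d k

module _ (c : Fin ℓ) (χ : Coloring n ℓ) where

  rainbowFree-power : 2 ≤ q → ¬ RainbowK q χ → ∀ k → ¬ RainbowK q (power c χ k)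
  rainbowFree-power 2≤q no-χ zero    = rainbowFree-K₁ 2≤q
  rainbowFree-power 2≤q no-χ (suc k) = rainbowFree-⊗ χ (power c χ k) no-χ (rainbowFree-power 2≤q no-χ k)

  deg-power : ∀ {d} → (∀ v c′ → deg χ v c′ ≡ d) → ∀ k v c′ → deg (power c χ k) v c′ ≡ iteratedDegree n d k
  deg-power regular zero    zero c′ = refl
  deg-power regular (suc k) v    c′ = trans (deg-⊗ χ (power c χ k) v c′)
    (cong₂ _+_ (cong (n ^ k *_) (regular _ c′)) (deg-power regular k _ c′))

  deg-power-≥ : ∀ {d} → (∀ v c′ → d ≤ deg χ v c′) → ∀ k v c′ → iteratedDegree n d k ≤ deg (power c χ k) v c′
  deg-power-≥ min-deg zero    v c′ = z≤n
  deg-power-≥ min-deg (suc k) v c′ = ≤-trans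
    (+-mono-≤ (*-monoʳ-≤ (n ^ k) (min-deg _ c′)) (deg-power-≥ min-deg k _ c′))
    (≤-reflexive (sym (deg-⊗ χ (power c χ k) v c′)))

m*n∸1≡n*[m∸1]+[n∸1] : ∀ m n .{{_ : NonZero m}} .{{_ : NonZero n}} → m * n ∸ 1 ≡ n * (m ∸ 1) + (n ∸ 1)
m*n∸1≡n*[m∸1]+[n∸1] (suc m) (suc n) = trans (+-comm n (m * suc n)) (cong (_+ n) (*-comm m (suc n)))

iteratedDegree-* : ∀ {d} .{{_ : NonZero n}} → d * ℓ ≡ n ∸ 1 → ∀ k → iteratedDegree n d k * ℓ ≡ n ^ k ∸ 1
iteratedDegree-* d*ℓ zero = refl
iteratedDegree-* {n} {ℓ} {d} d*ℓ (suc k) = begin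
  (n ^ k * d + e) * ℓ       ≡⟨ *-distribʳ-+ ℓ (n ^ k * d) e ⟩
  n ^ k * d * ℓ + e * ℓ     ≡⟨ cong₂ _+_ (*-assoc (n ^ k) d ℓ) (iteratedDegree-* d*ℓ k) ⟩
  n ^ k * (d * ℓ) + (n ^ k ∸ 1) ≡⟨ cong (λ x → n ^ k * x + (n ^ k ∸ 1)) d*ℓ ⟩
  n ^ k * (n ∸ 1) + (n ^ k ∸ 1) ≡⟨ m*n∸1≡n*[m∸1]+[n∸1] n (n ^ k) ⟨
  n * n ^ k ∸ 1 ∎
  where
  open ≡-Reasoning
  e = iteratedDegree n d k
  instance
    nᵏ≢0 : NonZero (n ^ k)
    nᵏ≢0 = m^n≢0 n k

exact⇒isFloorDiv : ∀ {m d} .{{_ : NonZero ℓ}} → d * ℓ ≡ m → IsFloorDiv m ℓ d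
exact⇒isFloorDiv {ℓ} {d = d} refl = ≤-reflexive refl , m<n+m (d * ℓ) (>-nonZero⁻¹ ℓ)

isFloorDiv⇒exact : ∀ {m d} .{{_ : NonZero ℓ}} → ℓ ∣ m → IsFloorDiv m ℓ d → d * ℓ ≡ m
isFloorDiv⇒exact {ℓ} {d = d} (divides c refl) (d*ℓ≤m , m<[1+d]*ℓ) =
  cong (_* ℓ) (≤-antisym (*-cancelʳ-≤ d c ℓ d*ℓ≤m) (≤-pred (*-cancelʳ-< ℓ c (suc d) m<[1+d]*ℓ)))

completelyBalanced-power : 1 ≤ n →
  (∃ λ (χ : Coloring n ℓ) → CompletelyBalanced χ × ¬ RainbowK q χ) →
  ∀ k → ∃ λ (χ : Coloring (n ^ k) ℓ) → CompletelyBalanced χ × ¬ RainbowK q χ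
completelyBalanced-power {suc n} {ℓ} _ (χ , (_ , balanced) , no-rainbow) k =
  power c χ k ,
  (divides e (sym e*ℓ) , λ v c′ → trans (cong (_* ℓ) (deg-power c χ regular k v c′)) e*ℓ) ,
  rainbowFree-power c χ (rainbowFree⇒2≤q χ zero no-rainbow) no-rainbow k
  where
  c = colour χ zero zero
  instance
    ℓ≢0 : NonZero ℓ
    ℓ≢0 = nonZeroIndex c
  d = deg χ zero c
  regular : ∀ v c′ → deg χ v c′ ≡ d
  regular v c′ = *-cancelʳ-≡ _ _ ℓ (trans (balanced v c′) (sym (balanced zero c)))
  e = iteratedDegree (suc n) d k
  e*ℓ : e * ℓ ≡ suc n ^ k ∸ 1
  e*ℓ = iteratedDegree-* {d = d} (balanced zero c) k

dInfinity-power : 1 ≤ n → 2 ≤ q → ℓ ∣ n ∸ 1 → DInfinityK n q ℓ →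
                  ∀ k → 1 ≤ k → DInfinityK (n ^ k) q ℓ
dInfinity-power {suc n} {q} {ℓ} _ 2≤q ℓ∣n∸1 (d , d-floor , χ , (all-colours , min-deg) , no-rainbow) (suc k) _ =
  e , exact⇒isFloorDiv {d = e} (iteratedDegree-* {d = d} d*ℓ (suc k)) ,
  power c χ (suc k) ,
  (usesAllColours-⊗ χ (power c χ k) (funToFin {k} (λ _ → zero)) all-colours , deg-power-≥ c χ min-deg (suc k)) ,
  rainbowFree-power c χ 2≤q no-rainbow (suc k)
  where
  c = colour χ zero zero
  instance
    ℓ≢0 : NonZero ℓ
    ℓ≢0 = nonZeroIndex c
  d*ℓ : d * ℓ ≡ suc n ∸ 1
  d*ℓ = isFloorDiv⇒exact {d = d} ℓ∣n∸1 d-floor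
  e = iteratedDegree (suc n) d (suc k)

lemma2 :
  (∀ (n ℓ q : ℕ) → 1 ≤ n → 1 ≤ ℓ → 1 ≤ q →
    (∃ λ (χ : Coloring n ℓ) → CompletelyBalanced χ × ¬ RainbowK q χ) →
    ∀ (k : ℕ) → 1 ≤ k →
    ∃ λ (χ : Coloring (n ^ k) ℓ) → CompletelyBalanced χ × ¬ RainbowK q χ)
  ×
  (∀ (n q : ℕ) → 1 ≤ n → 2 ≤ q → (q C 2) ∣ n ∸ 1 →
    DInfinityK n q (q C 2) →
    ∀ (k : ℕ) → 1 ≤ k → DInfinityK (n ^ k) q (q C 2))
lemma2 =
  (λ n ℓ q 1≤n _ _ balanced k _ → completelyBalanced-power 1≤n balanced k) ,
  (λ n q → dInfinity-power)
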